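{- Let $N\geq 3$ be an integer. Then there exists a set $A\subseteq \mathbb{N}$ such that $R_2(A,n)=R_2(\mathbb{N}\setminus A,n)$ for all integers $n\geq 2N-1$, $|A\cap A_0|=+\infty$, $|A\cap B_0|=+\infty$, and $$R_2(A,3N-1)=0.$$
   Context: $\mathbb{N}$ denotes the set of nonnegative integers (including $0$). For $A\subseteq\mathbb{N}$ and an integer $n$, $R_2(A,n)$ denotes the number of solutions of $n=a+a'$ with $a,a'\in A$ and $a<a'$. For $a\in\mathbb{N}$, $D(a)$ is the number of ones in the binary representation of $a$ (with $D(0)=0$). $A_0$ is the set of all $a\in\mathbb{N}$ with $D(a)$ even (the Thue–Morse set), and $B_0=\mathbb{N}\setminus A_0$. -}

module Defs where

open import Data.Nat using (ℕ; zero; suc; _+_; _*_; _∸_; _<ᵇ_; _%_; _/_)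
open import Data.Bool using (Bool; true; false; _∧_; if_then_else_)

Subset : Set
Subset = ℕ → Bool

compl : Subset → Subset
compl A n = Data.Bool.not (A n)

-- R₂(A,n) = #{ (a , a') : a + a' = n, a , a' ∈ A, a < a' }
-- counted by the smaller element a ∈ {0,…,n}, with a' = n ∸ a and a < a'.
countUpTo : (ℕ → Bool) → ℕ → ℕ
countUpTo P zero = 0
countUpTo P (suc k) = (if P k then 1 else 0) + countUpTo P k

R₂ : Subset → ℕ → ℕ
R₂ A n = countUpTo (λ a → A a ∧ A (n ∸ a) ∧ (a <ᵇ (n ∸ a))) (suc n)

-- D(a) = number of ones in the binary expansion of a (D 0 = 0).
-- Computed with fuel; fuel a suffices since a / 2 < a for a > 0.
popcountFuel : ℕ → ℕ → ℕ
popcountFuel zero    a = 0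
popcountFuel (suc f) a = a % 2 + popcountFuel f (a / 2)

D : ℕ → ℕ
D a = popcountFuel a a

-- Take a seed S ⊆ [0, 2N) with |S| = N and extend it by doubling: for m ≥ N put 2m in A iff m ∈ A,
-- and 2m + 1 in A iff m ∉ A.  Then |A ∩ [0, 2k)| = k for every k ≥ N.  Sorting the pairs
-- {a, n - a}, a < n - a, by how many of their members lie in A gives
-- R₂(A, n) - R₂(ℕ ∖ A, n) = |{a ≤ n : a ∈ A, 2a ≠ n}| - ⌈n/2⌉, which the counting property makes 0
-- as soon as n ≥ 2N - 1.  Since D(2m) = D(m) and D(2m + 1) = D(m) + 1, doubling keeps an element
-- of A beyond N inside A with the same digit sum, so two elements 2y, 2y + 1 ∈ A beyond N yield
-- infinitely many elements of A in A₀ and in B₀.  Finally the seed is chosen, separately for even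
-- and odd N, so that no two elements of A add up to 3N - 1.
module Submission where

open import Defs
open import Data.Nat using (ℕ; _≤_; _+_; _*_; _∸_)
open import Data.Nat.Divisibility using (_∣_)
open import Data.Bool using (true)
open import Data.Product using (Σ; _×_; ∃-syntax)
open import Relation.Nullary using (¬_)
open import Relation.Binary.PropositionalEquality using (_≡_)

open import Data.Bool using (Bool; false; not; _∧_; _xor_; if_then_else_)
open import Data.Bool.Properties using (∧-identityʳ; ∧-zeroʳ)
open import Data.Empty using (⊥-elim)
open import Data.Nat using (zero; suc; _<_; _<ᵇ_; _≡ᵇ_; _<?_; z≤n; s≤s; z<s; _%_; _/_; >-nonZero)
open import Data.Nat.DivMod using (m*n%n≡0; m*n/n≡m; [m+kn]%n≡m%n; +-distrib-/-∣ʳ; m/n<m)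
open import Data.Nat.Divisibility using (divides; n∣m⇒m%n≡0)
open import Data.Nat.Properties
open import Algebra.Properties.CommutativeSemigroup +-commutativeSemigroup using (interchange; x∙yz≈y∙xz)
open import Data.Nat.Tactic.RingSolver using (solve-∀)
open import Data.Product using (_,_)
open import Data.Sum using (_⊎_; inj₁; inj₂)
open import Data.Unit using (tt)
open import Function using (_⇔_; _∘_; mk⇔; Equivalence)
open import Relation.Nullary using (yes; no)
open import Relation.Binary.PropositionalEquality using (_≢_; refl; sym; trans; cong; cong₂; subst; subst₂; module ≡-Reasoning)

open Equivalence using (to; from)

𝟙 : Bool → ℕ
𝟙 b = if b then 1 else 0

<ᵇ-true : ∀ {m n} → m < n → (m <ᵇ n) ≡ true
<ᵇ-true {m} {n} m<n with m <ᵇ n | <⇒<ᵇ m<n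
... | true | _ = refl

<ᵇ-false : ∀ {m n} → n ≤ m → (m <ᵇ n) ≡ false
<ᵇ-false {m} {n} n≤m with m <ᵇ n | <ᵇ⇒< m n
... | false | _   = refl
... | true  | m<n = ⊥-elim (<⇒≱ (m<n tt) n≤m)

<ᵇ-cong : ∀ {m n o p} → (m < n ⇔ o < p) → (m <ᵇ n) ≡ (o <ᵇ p)
<ᵇ-cong {m} {n} m<n⇔o<p with m <? n
... | yes m<n = trans (<ᵇ-true m<n) (sym (<ᵇ-true (to m<n⇔o<p m<n)))
... | no  m≮n = trans (<ᵇ-false (≮⇒≥ m≮n)) (sym (<ᵇ-false (≮⇒≥ (m≮n ∘ from m<n⇔o<p))))

<ᵇ-flip : ∀ m a → (m <ᵇ a) ≡ not (a <ᵇ suc m)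
<ᵇ-flip m       zero    = refl
<ᵇ-flip zero    (suc a) = refl
<ᵇ-flip (suc m) (suc a) = <ᵇ-flip m a

+-<ᵇ-+ : ∀ k m n → (k + m <ᵇ k + n) ≡ (m <ᵇ n)
+-<ᵇ-+ zero    m n = refl
+-<ᵇ-+ (suc k) m n = +-<ᵇ-+ k m n

≡ᵇ-refl : ∀ m → (m ≡ᵇ m) ≡ true
≡ᵇ-refl zero    = refl
≡ᵇ-refl (suc m) = ≡ᵇ-refl m

≡ᵇ-false : ∀ {m n} → m ≢ n → (m ≡ᵇ n) ≡ false
≡ᵇ-false {m} {n} m≢n with m ≡ᵇ n | ≡ᵇ⇒≡ m n
... | false | _   = refl
... | true  | m≡n = ⊥-elim (m≢n (m≡n tt))

𝟙-<ᵇ-trichotomy : ∀ x a m → 𝟙 (x ∧ (a <ᵇ m)) + 𝟙 (x ∧ (m <ᵇ a)) ≡ 𝟙 (x ∧ not (a ≡ᵇ m))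
𝟙-<ᵇ-trichotomy false a       m       = refl
𝟙-<ᵇ-trichotomy true  zero    zero    = refl
𝟙-<ᵇ-trichotomy true  zero    (suc m) = refl
𝟙-<ᵇ-trichotomy true  (suc a) zero    = refl
𝟙-<ᵇ-trichotomy true  (suc a) (suc m) = 𝟙-<ᵇ-trichotomy true a m

𝟙-∧-split : ∀ x q → 𝟙 (x ∧ q) + 𝟙 (x ∧ not q) ≡ 𝟙 x
𝟙-∧-split false q     = refl
𝟙-∧-split true  false = refl
𝟙-∧-split true  true  = refl

𝟙-not+𝟙 : ∀ b c → 𝟙 (not b) + (𝟙 b + c) ≡ suc c
𝟙-not+𝟙 true  c = refl
𝟙-not+𝟙 false c = refl

𝟙-pair : ∀ x y p → 𝟙 (x ∧ y ∧ p) + 𝟙 p ≡ 𝟙 (not x ∧ not y ∧ p) + (𝟙 (x ∧ p) + 𝟙 (y ∧ p))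
𝟙-pair true  true  p     = refl
𝟙-pair true  false true  = refl
𝟙-pair true  false false = refl
𝟙-pair false true  true  = refl
𝟙-pair false true  false = refl
𝟙-pair false false true  = refl
𝟙-pair false false false = refl

-- Doubling and parity

2*≡+ : ∀ a → 2 * a ≡ a + a
2*≡+ a = cong (a +_) (+-identityʳ a)

data EvenOrOdd : ℕ → Set where
  even : ∀ m → EvenOrOdd (2 * m)
  odd  : ∀ m → EvenOrOdd (1 + 2 * m)

evenOrOdd : ∀ n → EvenOrOdd n
evenOrOdd zero = even 0
evenOrOdd (suc n) with evenOrOdd n
... | even m = odd m
... | odd m  = subst EvenOrOdd (*-suc 2 m) (even (suc m))

2*m%2≡0 : ∀ m → 2 * m % 2 ≡ 0
2*m%2≡0 m = trans (cong (_% 2) (*-comm 2 m)) (m*n%n≡0 m 2)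

2*m/2≡m : ∀ m → 2 * m / 2 ≡ m
2*m/2≡m m = trans (cong (_/ 2) (*-comm 2 m)) (m*n/n≡m m 2)

[1+2*m]%2≡1 : ∀ m → (1 + 2 * m) % 2 ≡ 1
[1+2*m]%2≡1 m = trans (cong (λ k → (1 + k) % 2) (*-comm 2 m)) ([m+kn]%n≡m%n 1 m 2)

[1+2*m]/2≡m : ∀ m → (1 + 2 * m) / 2 ≡ m
[1+2*m]/2≡m m = trans (+-distrib-/-∣ʳ 1 (divides m (*-comm 2 m))) (2*m/2≡m m)

2*≢1+2* : ∀ x y → 2 * x ≢ 1 + 2 * y
2*≢1+2* x y eq with () ← trans (sym (2*m%2≡0 x)) (trans (cong (_% 2) eq) ([1+2*m]%2≡1 y))

2∣2* : ∀ k → 2 ∣ 2 * k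
2∣2* k = divides k (*-comm 2 k)

2∤1+2* : ∀ k → ¬ 2 ∣ 1 + 2 * k
2∤1+2* k 2∣1+2k with () ← trans (sym ([1+2*m]%2≡1 k)) (n∣m⇒m%n≡0 _ 2 2∣1+2k)

divisibility-by-2-alternates : ∀ d → (2 ∣ d × ¬ 2 ∣ suc d) ⊎ (¬ 2 ∣ d × 2 ∣ suc d)
divisibility-by-2-alternates d with evenOrOdd d
... | even k = inj₁ (2∣2* k , 2∤1+2* k)
... | odd  k = inj₂ (2∤1+2* k , subst (2 ∣_) (*-suc 2 k) (2∣2* (suc k)))

isEven : ℕ → Bool
isEven a = a % 2 ≡ᵇ 0

isEven-2* : ∀ m → isEven (2 * m) ≡ true
isEven-2* m = cong (_≡ᵇ 0) (2*m%2≡0 m)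

isEven-1+2* : ∀ m → isEven (1 + 2 * m) ≡ false
isEven-1+2* m = cong (_≡ᵇ 0) ([1+2*m]%2≡1 m)

/2< : ∀ {x} → 0 < x → x / 2 < x
/2< 0<x = m/n<m _ 2 {{>-nonZero 0<x}} (s≤s (s≤s z≤n))

1+[n∸1]≡n : ∀ {n} → 0 < n → suc (n ∸ 1) ≡ n
1+[n∸1]≡n {suc n} _ = refl

smaller<half : ∀ {a a' h} → a < a' → a + a' ≡ 2 * h → a < h
smaller<half {a} {a'} a<a' eq = *-cancelˡ-< 2 a _ (subst₂ _<_ (sym (2*≡+ a)) eq (+-monoʳ-< a a<a'))

half≤larger : ∀ {a a' h} → a < a' → suc (a + a') ≡ 2 * h → h ≤ a'
half≤larger {a} {a'} a<a' eq = *-cancelˡ-≤ 2 (subst₂ _≤_ eq (sym (2*≡+ a')) (+-monoˡ-≤ a' a<a'))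

2*∸1≤2*⇒≤ : ∀ {N m} → 2 * N ∸ 1 ≤ 2 * m → N ≤ m
2*∸1≤2*⇒≤ {N} {m} h = ≮⇒≥ λ m<N →
  1+n≰n (≤-trans (subst (_≤ 2 * N) (*-suc 2 m) (*-monoʳ-≤ 2 m<N))
                 (≤-trans (m≤n+m∸n (2 * N) 1) (s≤s h)))

2*∸1≤1+2*⇒≤ : ∀ {N m} → 2 * N ∸ 1 ≤ 1 + 2 * m → N ≤ suc m
2*∸1≤1+2*⇒≤ {N} {m} h =
  *-cancelˡ-≤ 2 (subst (2 * N ≤_) (sym (*-suc 2 m)) (≤-trans (m≤n+m∸n (2 * N) 1) (s≤s h)))

-- Counting

sumUpTo : (ℕ → ℕ) → ℕ → ℕ
sumUpTo f zero    = 0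
sumUpTo f (suc k) = f k + sumUpTo f k

countUpTo≡sumUpTo : ∀ P k → countUpTo P k ≡ sumUpTo (𝟙 ∘ P) k
countUpTo≡sumUpTo P zero    = refl
countUpTo≡sumUpTo P (suc k) = cong (𝟙 (P k) +_) (countUpTo≡sumUpTo P k)

sumUpTo-cong : ∀ {f g} k → (∀ a → a < k → f a ≡ g a) → sumUpTo f k ≡ sumUpTo g k
sumUpTo-cong zero    f≗g = refl
sumUpTo-cong (suc k) f≗g = cong₂ _+_ (f≗g k ≤-refl) (sumUpTo-cong k (λ a a<k → f≗g a (m<n⇒m<1+n a<k)))

sumUpTo-+ : ∀ f g k → sumUpTo (λ a → f a + g a) k ≡ sumUpTo f k + sumUpTo g k
sumUpTo-+ f g zero    = refl
sumUpTo-+ f g (suc k) = trans (cong (f k + g k +_) (sumUpTo-+ f g k)) (interchange (f k) (g k) _ _)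

sumUpTo-shift : ∀ f k → sumUpTo f (suc k) ≡ f 0 + sumUpTo (f ∘ suc) k
sumUpTo-shift f zero    = refl
sumUpTo-shift f (suc k) = trans (cong (f (suc k) +_) (sumUpTo-shift f k)) (x∙yz≈y∙xz (f (suc k)) (f 0) _)

sumUpTo-reverse : ∀ f n → sumUpTo f (suc n) ≡ sumUpTo (λ a → f (n ∸ a)) (suc n)
sumUpTo-reverse f zero    = refl
sumUpTo-reverse f (suc n) =
  trans (cong (f (suc n) +_) (sumUpTo-reverse f n)) (sym (sumUpTo-shift (λ a → f (suc n ∸ a)) (suc n)))

countUpTo-cong : ∀ {P Q} k → (∀ a → a < k → P a ≡ Q a) → countUpTo P k ≡ countUpTo Q k
countUpTo-cong zero    P≗Q = refl
countUpTo-cong (suc k) P≗Q =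
  cong₂ (λ b c → 𝟙 b + c) (P≗Q k ≤-refl) (countUpTo-cong k (λ a a<k → P≗Q a (m<n⇒m<1+n a<k)))

countUpTo-+ : ∀ (P Q R : ℕ → Bool) k → (∀ a → a < k → 𝟙 (P a) + 𝟙 (Q a) ≡ 𝟙 (R a)) →
              countUpTo P k + countUpTo Q k ≡ countUpTo R k
countUpTo-+ P Q R zero    PQ≗R = refl
countUpTo-+ P Q R (suc k) PQ≗R = trans (interchange (𝟙 (P k)) _ (𝟙 (Q k)) _)
  (cong₂ _+_ (PQ≗R k ≤-refl) (countUpTo-+ P Q R k (λ a a<k → PQ≗R a (m<n⇒m<1+n a<k))))

countUpTo-∧-split : ∀ (P Q : ℕ → Bool) k →
  countUpTo (λ a → P a ∧ Q a) k + countUpTo (λ a → P a ∧ not (Q a)) k ≡ countUpTo P k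
countUpTo-∧-split P Q k =
  countUpTo-+ (λ a → P a ∧ Q a) (λ a → P a ∧ not (Q a)) P k (λ a _ → 𝟙-∧-split (P a) (Q a))

countUpTo-false : ∀ P k → (∀ a → a < k → P a ≡ false) → countUpTo P k ≡ 0
countUpTo-false P zero    P≗false = refl
countUpTo-false P (suc k) P≗false = cong₂ (λ b c → 𝟙 b + c) (P≗false k ≤-refl)
  (countUpTo-false P k (λ a a<k → P≗false a (m<n⇒m<1+n a<k)))

countUpTo-true : ∀ P k → (∀ a → a < k → P a ≡ true) → countUpTo P k ≡ k
countUpTo-true P zero    P≗true = refl
countUpTo-true P (suc k) P≗true = cong₂ (λ b c → 𝟙 b + c) (P≗true k ≤-refl)
  (countUpTo-true P k (λ a a<k → P≗true a (m<n⇒m<1+n a<k)))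

countUpTo-<ᵇ : ∀ k l → k ≤ l → countUpTo (_<ᵇ k) l ≡ k
countUpTo-<ᵇ k zero    z≤n = refl
countUpTo-<ᵇ k (suc l) k≤1+l with m≤n⇒m<n∨m≡n k≤1+l
... | inj₂ refl = countUpTo-true (_<ᵇ suc l) (suc l) (λ a → <ᵇ-true)
... | inj₁ k<1+l = trans (cong (λ b → 𝟙 b + countUpTo (_<ᵇ k) l) (<ᵇ-false (≤-pred k<1+l)))
                          (countUpTo-<ᵇ k l (≤-pred k<1+l))

countUpTo-≡ᵇ : ∀ (P : ℕ → Bool) m k → m < k → countUpTo (λ a → P a ∧ (a ≡ᵇ m)) k ≡ 𝟙 (P m)
countUpTo-≡ᵇ P m (suc k) m<1+k with m≤n⇒m<n∨m≡n (≤-pred m<1+k)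
... | inj₂ refl = begin
    𝟙 (P m ∧ (m ≡ᵇ m)) + countUpTo (λ a → P a ∧ (a ≡ᵇ m)) m
      ≡⟨ cong₂ (λ b c → 𝟙 b + c) (trans (cong (P m ∧_) (≡ᵇ-refl m)) (∧-identityʳ (P m)))
               (countUpTo-false _ m (λ a a<m → P∧≢ (<⇒≢ a<m))) ⟩
    𝟙 (P m) + 0
      ≡⟨ +-identityʳ _ ⟩
    𝟙 (P m) ∎
  where
  open ≡-Reasoning
  P∧≢ : ∀ {a} → a ≢ m → (P a ∧ (a ≡ᵇ m)) ≡ false
  P∧≢ {a} a≢m = trans (cong (P a ∧_) (≡ᵇ-false a≢m)) (∧-zeroʳ (P a))
... | inj₁ m<k = cong₂ (λ b c → 𝟙 b + c) (trans (cong (P k ∧_) (≡ᵇ-false (>⇒≢ m<k))) (∧-zeroʳ (P k)))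
                       (countUpTo-≡ᵇ P m k m<k)

countUpTo-split : ∀ P m n → countUpTo P (m + n) ≡ countUpTo (λ a → P (n + a)) m + countUpTo P n
countUpTo-split P zero    n = refl
countUpTo-split P (suc m) n = trans (cong₂ (λ b c → 𝟙 (P b) + c) (+-comm m n) (countUpTo-split P m n))
                                    (sym (+-assoc (𝟙 (P (n + m))) _ _))

countUpTo-alternating : ∀ (P : ℕ → Bool) N → (∀ m → N ≤ m → P (1 + 2 * m) ≡ not (P (2 * m))) →
                        countUpTo P (2 * N) ≡ N → ∀ k → N ≤ k → countUpTo P (2 * k) ≡ k
countUpTo-alternating P N alternates base k N≤k with m≤n⇒m<n∨m≡n N≤k
... | inj₂ refl = base
countUpTo-alternating P N alternates base (suc k) _ | inj₁ (s≤s N≤k) = begin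
  countUpTo P (2 * suc k)
    ≡⟨ cong (countUpTo P) (*-suc 2 k) ⟩
  𝟙 (P (1 + 2 * k)) + (𝟙 (P (2 * k)) + countUpTo P (2 * k))
    ≡⟨ cong₂ (λ b c → 𝟙 b + (𝟙 (P (2 * k)) + c)) (alternates k N≤k)
             (countUpTo-alternating P N alternates base k N≤k) ⟩
  𝟙 (not (P (2 * k))) + (𝟙 (P (2 * k)) + k)
    ≡⟨ 𝟙-not+𝟙 (P (2 * k)) k ⟩
  suc k ∎
  where open ≡-Reasoning

countUpTo-isEven : ∀ k → countUpTo isEven (2 * k) ≡ k
countUpTo-isEven k = countUpTo-alternating isEven 0
  (λ m _ → trans (isEven-1+2* m) (cong not (sym (isEven-2* m)))) refl k z≤n

-- R₂(A, n) versus R₂(ℕ ∖ A, n)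

belowHalf aboveHalf : ℕ → ℕ → Bool
belowHalf n a = a <ᵇ n ∸ a
aboveHalf n a = n ∸ a <ᵇ a

R₂-complement : ∀ (A : Subset) n →
  R₂ A n + countUpTo (belowHalf n) (suc n) ≡
  R₂ (compl A) n + (countUpTo (λ a → A a ∧ belowHalf n a) (suc n) + countUpTo (λ a → A a ∧ aboveHalf n a) (suc n))
R₂-complement A n = begin
  R₂ A n + countUpTo (belowHalf n) (suc n)
    ≡⟨ cong₂ _+_ (countUpTo≡sumUpTo inA (suc n)) (countUpTo≡sumUpTo (belowHalf n) (suc n)) ⟩
  sumUpTo (𝟙 ∘ inA) (suc n) + sumUpTo (𝟙 ∘ belowHalf n) (suc n)
    ≡⟨ sym (sumUpTo-+ (𝟙 ∘ inA) (𝟙 ∘ belowHalf n) (suc n)) ⟩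
  sumUpTo (λ a → 𝟙 (inA a) + 𝟙 (belowHalf n a)) (suc n)
    ≡⟨ sumUpTo-cong (suc n) (λ a _ → 𝟙-pair (A a) (A (n ∸ a)) (belowHalf n a)) ⟩
  sumUpTo (λ a → 𝟙 (inAᶜ a) + (𝟙 (small a) + 𝟙 (smallPartner a))) (suc n)
    ≡⟨ sumUpTo-+ (𝟙 ∘ inAᶜ) (λ a → 𝟙 (small a) + 𝟙 (smallPartner a)) (suc n) ⟩
  sumUpTo (𝟙 ∘ inAᶜ) (suc n) + sumUpTo (λ a → 𝟙 (small a) + 𝟙 (smallPartner a)) (suc n)
    ≡⟨ cong (sumUpTo (𝟙 ∘ inAᶜ) (suc n) +_) (sumUpTo-+ (𝟙 ∘ small) (𝟙 ∘ smallPartner) (suc n)) ⟩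
  sumUpTo (𝟙 ∘ inAᶜ) (suc n) + (sumUpTo (𝟙 ∘ small) (suc n) + sumUpTo (𝟙 ∘ smallPartner) (suc n))
    ≡⟨ cong₂ _+_ (sym (countUpTo≡sumUpTo inAᶜ (suc n)))
                 (cong₂ _+_ (sym (countUpTo≡sumUpTo small (suc n))) reflected) ⟩
  R₂ (compl A) n + (countUpTo small (suc n) + countUpTo large (suc n)) ∎
  where
  open ≡-Reasoning
  inA inAᶜ small large smallPartner : ℕ → Bool
  inA a = A a ∧ A (n ∸ a) ∧ belowHalf n a
  inAᶜ a = compl A a ∧ compl A (n ∸ a) ∧ belowHalf n a
  small a = A a ∧ belowHalf n a
  large a = A a ∧ aboveHalf n a
  smallPartner a = A (n ∸ a) ∧ belowHalf n a
  reflected : sumUpTo (𝟙 ∘ smallPartner) (suc n) ≡ countUpTo large (suc n)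
  reflected = begin
    sumUpTo (𝟙 ∘ smallPartner) (suc n)
      ≡⟨ sumUpTo-reverse (𝟙 ∘ smallPartner) n ⟩
    sumUpTo (λ b → 𝟙 (A (n ∸ (n ∸ b)) ∧ (n ∸ b <ᵇ n ∸ (n ∸ b)))) (suc n)
      ≡⟨ sumUpTo-cong (suc n) (λ b b≤n →
           cong (λ c → 𝟙 (A c ∧ (n ∸ b <ᵇ c))) (m∸[m∸n]≡n (≤-pred b≤n))) ⟩
    sumUpTo (𝟙 ∘ large) (suc n)
      ≡⟨ sym (countUpTo≡sumUpTo large (suc n)) ⟩
    countUpTo large (suc n) ∎

<∸⇔2*< : ∀ {a n} → a ≤ n → (a < n ∸ a ⇔ 2 * a < n)
<∸⇔2*< {a} {n} a≤n = mk⇔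
  (λ a<n∸a → subst (_≤ n) (cong suc (sym (2*≡+ a))) (m≤o∸n⇒m+n≤o (suc a) a≤n a<n∸a))
  (λ 2a<n → m+n≤o⇒m≤o∸n (suc a) (subst (_≤ n) (cong suc (2*≡+ a)) 2a<n))

∸<⇔<2* : ∀ {a n} → a ≤ n → (n ∸ a < a ⇔ n < 2 * a)
∸<⇔<2* {a} {n} a≤n = mk⇔
  (λ n∸a<a → subst₂ _<_ (m∸n+n≡m a≤n) (sym (2*≡+ a)) (+-monoˡ-< a n∸a<a))
  (λ n<2a → subst (n ∸ a <_) (m+n∸n≡m a a) (∸-monoˡ-< (subst (n <_) (2*≡+ a) n<2a) a≤n))

belowHalf-even : ∀ m {a} → a ≤ 2 * m → belowHalf (2 * m) a ≡ (a <ᵇ m)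
belowHalf-even m {a} a≤2m = <ᵇ-cong {a} {2 * m ∸ a} {a} {m} (mk⇔
  (λ h → *-cancelˡ-< 2 a m (to (<∸⇔2*< a≤2m) h))
  (λ a<m → from (<∸⇔2*< a≤2m) (*-monoʳ-< 2 a<m)))

aboveHalf-even : ∀ m {a} → a ≤ 2 * m → aboveHalf (2 * m) a ≡ (m <ᵇ a)
aboveHalf-even m {a} a≤2m = <ᵇ-cong {2 * m ∸ a} {a} {m} {a} (mk⇔
  (λ h → *-cancelˡ-< 2 m a (to (∸<⇔<2* a≤2m) h))
  (λ m<a → from (∸<⇔<2* a≤2m) (*-monoʳ-< 2 m<a)))

belowHalf-odd : ∀ m {a} → a ≤ 1 + 2 * m → belowHalf (1 + 2 * m) a ≡ (a <ᵇ suc m)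
belowHalf-odd m {a} a≤n = <ᵇ-cong {a} {1 + 2 * m ∸ a} {a} {suc m} (mk⇔
  (λ h → s≤s (*-cancelˡ-≤ 2 (≤-pred (to (<∸⇔2*< a≤n) h))))
  (λ a<1+m → from (<∸⇔2*< a≤n) (s≤s (*-monoʳ-≤ 2 (≤-pred a<1+m)))))

aboveHalf-odd : ∀ m {a} → a ≤ 1 + 2 * m → aboveHalf (1 + 2 * m) a ≡ (m <ᵇ a)
aboveHalf-odd m {a} a≤n = <ᵇ-cong {1 + 2 * m ∸ a} {a} {m} {a} (mk⇔
  (λ h → *-cancelˡ-< 2 m a (<-trans (n<1+n (2 * m)) (to (∸<⇔<2* a≤n) h)))
  (λ m<a → from (∸<⇔<2* a≤n) (subst (_≤ 2 * a) (*-suc 2 m) (*-monoʳ-≤ 2 m<a))))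

R₂-complement-odd : ∀ (A : Subset) m → countUpTo A (2 + 2 * m) ≡ suc m →
                    R₂ A (1 + 2 * m) ≡ R₂ (compl A) (1 + 2 * m)
R₂-complement-odd A m count≡ = +-cancelʳ-≡ _ _ _ (begin
  R₂ A n + countUpTo (belowHalf n) (suc n)
    ≡⟨ R₂-complement A n ⟩
  R₂ (compl A) n + (countUpTo (λ a → A a ∧ belowHalf n a) (suc n) + countUpTo (λ a → A a ∧ aboveHalf n a) (suc n))
    ≡⟨ cong (R₂ (compl A) n +_) (cong₂ _+_
         (countUpTo-cong (suc n) (λ a a≤n → cong (A a ∧_) (belowHalf-odd m (≤-pred a≤n))))
         (countUpTo-cong (suc n) (λ a a≤n →
           cong (A a ∧_) (trans (aboveHalf-odd m (≤-pred a≤n)) (<ᵇ-flip m a))))) ⟩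
  R₂ (compl A) n + (countUpTo (λ a → A a ∧ (a <ᵇ suc m)) (suc n)
                    + countUpTo (λ a → A a ∧ not (a <ᵇ suc m)) (suc n))
    ≡⟨ cong (R₂ (compl A) n +_) (trans (countUpTo-∧-split A (_<ᵇ suc m) (suc n)) count≡) ⟩
  R₂ (compl A) n + suc m
    ≡⟨ cong (R₂ (compl A) n +_) (sym pairs) ⟩
  R₂ (compl A) n + countUpTo (belowHalf n) (suc n) ∎)
  where
  open ≡-Reasoning
  n = 1 + 2 * m
  pairs : countUpTo (belowHalf n) (suc n) ≡ suc m
  pairs = trans (countUpTo-cong (suc n) (λ a a≤n → belowHalf-odd m (≤-pred a≤n)))
                (countUpTo-<ᵇ (suc m) (suc n) (s≤s (≤-trans (m≤m+n m (m + 0)) (n≤1+n (2 * m)))))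

R₂-complement-even : ∀ (A : Subset) m → countUpTo A (1 + 2 * m) ≡ m + 𝟙 (A m) →
                     R₂ A (2 * m) ≡ R₂ (compl A) (2 * m)
R₂-complement-even A m count≡ = +-cancelʳ-≡ _ _ _ (begin
  R₂ A n + countUpTo (belowHalf n) (suc n)
    ≡⟨ R₂-complement A n ⟩
  R₂ (compl A) n + (countUpTo (λ a → A a ∧ belowHalf n a) (suc n) + countUpTo (λ a → A a ∧ aboveHalf n a) (suc n))
    ≡⟨ cong (R₂ (compl A) n +_)
         (countUpTo-+ (λ a → A a ∧ belowHalf n a) (λ a → A a ∧ aboveHalf n a) offCentre (suc n) (λ a a≤n →
           trans (cong₂ (λ b c → 𝟙 (A a ∧ b) + 𝟙 (A a ∧ c))
                        (belowHalf-even m (≤-pred a≤n)) (aboveHalf-even m (≤-pred a≤n)))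
                 (𝟙-<ᵇ-trichotomy (A a) a m))) ⟩
  R₂ (compl A) n + countUpTo offCentre (suc n)
    ≡⟨ cong (R₂ (compl A) n +_) (trans offCentre≡ (sym pairs)) ⟩
  R₂ (compl A) n + countUpTo (belowHalf n) (suc n) ∎)
  where
  open ≡-Reasoning
  n = 2 * m
  m≤n : m ≤ n
  m≤n = m≤m+n m (m + 0)
  offCentre : ℕ → Bool
  offCentre a = A a ∧ not (a ≡ᵇ m)
  offCentre≡ : countUpTo offCentre (suc n) ≡ m
  offCentre≡ = +-cancelˡ-≡ (𝟙 (A m)) _ _ (begin
    𝟙 (A m) + countUpTo offCentre (suc n)
      ≡⟨ cong (_+ countUpTo offCentre (suc n)) (sym (countUpTo-≡ᵇ A m (suc n) (s≤s m≤n))) ⟩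
    countUpTo (λ a → A a ∧ (a ≡ᵇ m)) (suc n) + countUpTo offCentre (suc n)
      ≡⟨ countUpTo-∧-split A (_≡ᵇ m) (suc n) ⟩
    countUpTo A (suc n)
      ≡⟨ count≡ ⟩
    m + 𝟙 (A m)
      ≡⟨ +-comm m (𝟙 (A m)) ⟩
    𝟙 (A m) + m ∎)
  pairs : countUpTo (belowHalf n) (suc n) ≡ m
  pairs = trans (countUpTo-cong (suc n) (λ a a≤n → belowHalf-even m (≤-pred a≤n)))
                (countUpTo-<ᵇ m (suc n) (≤-trans m≤n (n≤1+n n)))

R₂-self-complementary : ∀ (A : Subset) N →
  (∀ m → N ≤ m → A (2 * m) ≡ A m) →
  (∀ m → N ≤ m → A (1 + 2 * m) ≡ not (A m)) →
  countUpTo A (2 * N) ≡ N →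
  ∀ n → 2 * N ∸ 1 ≤ n → R₂ A n ≡ R₂ (compl A) n
R₂-self-complementary A N doubles flips base n N≤n = balanced (evenOrOdd n) N≤n
  where
  open ≡-Reasoning
  count : ∀ k → N ≤ k → countUpTo A (2 * k) ≡ k
  count = countUpTo-alternating A N (λ m N≤m → trans (flips m N≤m) (cong not (sym (doubles m N≤m)))) base
  balanced : ∀ {n} → EvenOrOdd n → 2 * N ∸ 1 ≤ n → R₂ A n ≡ R₂ (compl A) n
  balanced (even m) h = R₂-complement-even A m (begin
    𝟙 (A (2 * m)) + countUpTo A (2 * m)
      ≡⟨ cong₂ (λ b c → 𝟙 b + c) (doubles m (2*∸1≤2*⇒≤ h)) (count m (2*∸1≤2*⇒≤ h)) ⟩
    𝟙 (A m) + m
      ≡⟨ +-comm (𝟙 (A m)) m ⟩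
    m + 𝟙 (A m) ∎)
  balanced (odd m) h = R₂-complement-odd A m
    (trans (cong (countUpTo A) (sym (*-suc 2 m))) (count (suc m) (2*∸1≤1+2*⇒≤ h)))

R₂≡0 : ∀ (A : Subset) n → (∀ a a' → a + a' ≡ n → a < a' → A a ≡ false ⊎ A a' ≡ false) → R₂ A n ≡ 0
R₂≡0 A n noPair = countUpTo-false _ (suc n) (λ a a≤n → noPairAt a (≤-pred a≤n))
  where
  noPairAt : ∀ a → a ≤ n → (A a ∧ A (n ∸ a) ∧ (a <ᵇ n ∸ a)) ≡ false
  noPairAt a a≤n with a <? n ∸ a
  ... | no a≮n∸a rewrite <ᵇ-false (≮⇒≥ a≮n∸a) = trans (cong (A a ∧_) (∧-zeroʳ (A (n ∸ a)))) (∧-zeroʳ (A a))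
  ... | yes a<n∸a with noPair a (n ∸ a) (m+[n∸m]≡n a≤n) a<n∸a
  ...   | inj₁ a∉A  rewrite a∉A  = refl
  ...   | inj₂ a'∉A rewrite a'∉A = ∧-zeroʳ (A a)

-- Binary digit sum

popcountFuel-0 : ∀ f → popcountFuel f 0 ≡ 0
popcountFuel-0 zero    = refl
popcountFuel-0 (suc f) = popcountFuel-0 f

/2≤ : ∀ {a f} → a ≤ suc f → a / 2 ≤ f
/2≤ {zero}  _     = z≤n
/2≤ {suc a} a≤1+f = ≤-pred (<-≤-trans (/2< z<s) a≤1+f)

popcountFuel-fuel : ∀ f g a → a ≤ f → a ≤ g → popcountFuel f a ≡ popcountFuel g a
popcountFuel-fuel zero    zero    a z≤n _   = refl
popcountFuel-fuel zero    (suc g) a z≤n _   = sym (popcountFuel-0 (suc g))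
popcountFuel-fuel (suc f) zero    a _   z≤n = popcountFuel-0 (suc f)
popcountFuel-fuel (suc f) (suc g) a a≤f a≤g = cong (a % 2 +_) (popcountFuel-fuel f g (a / 2) (/2≤ a≤f) (/2≤ a≤g))

D-unfold : ∀ a → D a ≡ a % 2 + D (a / 2)
D-unfold a = trans (popcountFuel-fuel a (suc a) a ≤-refl (n≤1+n a))
                   (cong (a % 2 +_) (popcountFuel-fuel a (a / 2) (a / 2) (/2≤ (n≤1+n a)) ≤-refl))

D-double : ∀ m → D (2 * m) ≡ D m
D-double m = trans (D-unfold (2 * m)) (cong₂ (λ r q → r + D q) (2*m%2≡0 m) (2*m/2≡m m))

D-double+1 : ∀ m → D (1 + 2 * m) ≡ suc (D m)
D-double+1 m = trans (D-unfold (1 + 2 * m)) (cong₂ (λ r q → r + D q) ([1+2*m]%2≡1 m) ([1+2*m]/2≡m m))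

Unbounded : (ℕ → Set) → Set
Unbounded P = ∀ m → ∃[ a ] (m ≤ a × P a)

doubling-orbit-unbounded : ∀ (A : Subset) N → 0 < N → (∀ m → N ≤ m → A (2 * m) ≡ A m) →
  ∀ (Q : ℕ → Set) {x} → N ≤ x → A x ≡ true → Q (D x) → Unbounded (λ a → A a ≡ true × Q (D a))
doubling-orbit-unbounded A N 0<N doubles Q {x} N≤x x∈A Qx M =
  let a , M≤a , _ , a∈A , Da≡Dx = orbit M in a , M≤a , a∈A , subst Q (sym Da≡Dx) Qx
  where
  orbit : ∀ M → ∃[ a ] (M ≤ a × N ≤ a × A a ≡ true × D a ≡ D x)
  orbit zero    = x , z≤n , N≤x , x∈A , refl
  orbit (suc M) =
    let a , M≤a , N≤a , a∈A , Da≡Dx = orbit M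
    in 2 * a , subst (suc M ≤_) (sym (2*≡+ a)) (+-mono-≤ (<-≤-trans 0<N N≤a) M≤a)
             , ≤-trans N≤a (m≤m+n a (a + 0))
             , trans (doubles a N≤a) a∈A
             , trans (D-double a) Da≡Dx

D-parities-unbounded : ∀ (A : Subset) N → 0 < N → (∀ m → N ≤ m → A (2 * m) ≡ A m) →
  ∀ y → N ≤ 2 * y → A (2 * y) ≡ true → A (1 + 2 * y) ≡ true →
  Unbounded (λ a → A a ≡ true × 2 ∣ D a) × Unbounded (λ a → A a ≡ true × ¬ 2 ∣ D a)
D-parities-unbounded A N 0<N doubles y N≤2y 2y∈A 1+2y∈A = byParity (divisibility-by-2-alternates (D y))
  where
  orbit = doubling-orbit-unbounded A N 0<N doubles
  N≤1+2y = m≤n⇒m≤1+n N≤2y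
  byParity : (2 ∣ D y × ¬ 2 ∣ suc (D y)) ⊎ (¬ 2 ∣ D y × 2 ∣ suc (D y)) →
             Unbounded (λ a → A a ≡ true × 2 ∣ D a) × Unbounded (λ a → A a ≡ true × ¬ 2 ∣ D a)
  byParity (inj₁ (2∣Dy , 2∤1+Dy)) =
    orbit (2 ∣_) N≤2y 2y∈A (subst (2 ∣_) (sym (D-double y)) 2∣Dy) ,
    orbit (λ d → ¬ 2 ∣ d) N≤1+2y 1+2y∈A (subst (λ d → ¬ 2 ∣ d) (sym (D-double+1 y)) 2∤1+Dy)
  byParity (inj₂ (2∤Dy , 2∣1+Dy)) =
    orbit (2 ∣_) N≤1+2y 1+2y∈A (subst (2 ∣_) (sym (D-double+1 y)) 2∣1+Dy) ,
    orbit (λ d → ¬ 2 ∣ d) N≤2y 2y∈A (subst (λ d → ¬ 2 ∣ d) (sym (D-double y)) 2∤Dy)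

-- The doubling extension of a seed

Admissible : ℕ → Subset → Set
Admissible N A = ((n : ℕ) → 2 * N ∸ 1 ≤ n → R₂ A n ≡ R₂ (compl A) n)
               × Unbounded (λ a → A a ≡ true × 2 ∣ D a)
               × Unbounded (λ a → A a ≡ true × ¬ 2 ∣ D a)
               × R₂ A (3 * N ∸ 1) ≡ 0

module DoublingExtension (N : ℕ) (0<N : 0 < N) (seed : Subset) where

  -- Since x / 2 < x once x ≥ 2N, the fuel suc x is never exhausted: the value at fuel 0 is junk.
  extendFuel : ℕ → Subset
  extendFuel zero    x = false
  extendFuel (suc f) x = if x <ᵇ 2 * N then seed x else (x % 2 ≡ᵇ 1) xor extendFuel f (x / 2)

  extension : Subset
  extension x = extendFuel (suc x) x

  extendFuel-seed : ∀ f {x} → x < 2 * N → extendFuel (suc f) x ≡ seed x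
  extendFuel-seed f x<2N rewrite <ᵇ-true x<2N = refl

  extendFuel-beyond : ∀ f {x} → 2 * N ≤ x → extendFuel (suc f) x ≡ (x % 2 ≡ᵇ 1) xor extendFuel f (x / 2)
  extendFuel-beyond f 2N≤x rewrite <ᵇ-false 2N≤x = refl

  extendFuel-fuel : ∀ f g x → x < f → x < g → extendFuel f x ≡ extendFuel g x
  extendFuel-fuel (suc f) (suc g) x x≤f x≤g with x <? 2 * N
  ... | yes x<2N = trans (extendFuel-seed f x<2N) (sym (extendFuel-seed g x<2N))
  ... | no  x≮2N = begin
    extendFuel (suc f) x
      ≡⟨ extendFuel-beyond f 2N≤x ⟩
    (x % 2 ≡ᵇ 1) xor extendFuel f (x / 2)
      ≡⟨ cong ((x % 2 ≡ᵇ 1) xor_) (extendFuel-fuel f g (x / 2) (half< x≤f) (half< x≤g)) ⟩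
    (x % 2 ≡ᵇ 1) xor extendFuel g (x / 2)
      ≡⟨ sym (extendFuel-beyond g 2N≤x) ⟩
    extendFuel (suc g) x ∎
    where
    open ≡-Reasoning
    2N≤x = ≮⇒≥ x≮2N
    half< : ∀ {f} → x < suc f → x / 2 < f
    half< x≤f = <-≤-trans (/2< (<-≤-trans (*-monoʳ-< 2 0<N) 2N≤x)) (≤-pred x≤f)

  extension-seed : ∀ {x} → x < 2 * N → extension x ≡ seed x
  extension-seed {x} = extendFuel-seed x

  extension-double : ∀ m → N ≤ m → extension (2 * m) ≡ extension m
  extension-double m N≤m = begin
    extendFuel (suc (2 * m)) (2 * m)
      ≡⟨ extendFuel-beyond (2 * m) (*-monoʳ-≤ 2 N≤m) ⟩
    (2 * m % 2 ≡ᵇ 1) xor extendFuel (2 * m) (2 * m / 2)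
      ≡⟨ cong₂ (λ r q → (r ≡ᵇ 1) xor extendFuel (2 * m) q) (2*m%2≡0 m) (2*m/2≡m m) ⟩
    extendFuel (2 * m) m
      ≡⟨ extendFuel-fuel (2 * m) (suc m) m (subst (m <_) (sym (2*≡+ m)) (m<m+n m (<-≤-trans 0<N N≤m))) ≤-refl ⟩
    extension m ∎
    where open ≡-Reasoning

  extension-double+1 : ∀ m → N ≤ m → extension (1 + 2 * m) ≡ not (extension m)
  extension-double+1 m N≤m = begin
    extendFuel (suc (1 + 2 * m)) (1 + 2 * m)
      ≡⟨ extendFuel-beyond (1 + 2 * m) (m≤n⇒m≤1+n (*-monoʳ-≤ 2 N≤m)) ⟩
    ((1 + 2 * m) % 2 ≡ᵇ 1) xor extendFuel (1 + 2 * m) ((1 + 2 * m) / 2)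
      ≡⟨ cong₂ (λ r q → (r ≡ᵇ 1) xor extendFuel (1 + 2 * m) q) ([1+2*m]%2≡1 m) ([1+2*m]/2≡m m) ⟩
    not (extendFuel (1 + 2 * m) m)
      ≡⟨ cong not (extendFuel-fuel (1 + 2 * m) (suc m) m (s≤s (m≤m+n m (m + 0))) ≤-refl) ⟩
    not (extension m) ∎
    where open ≡-Reasoning

  extension-admissible : countUpTo seed (2 * N) ≡ N →
    ∀ y → N ≤ 2 * y → extension (2 * y) ≡ true → extension (1 + 2 * y) ≡ true →
    R₂ extension (3 * N ∸ 1) ≡ 0 → Admissible N extension
  extension-admissible count y N≤2y 2y∈A 1+2y∈A R₂≡0 =
    let evenD , oddD = D-parities-unbounded extension N 0<N extension-double y N≤2y 2y∈A 1+2y∈A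
    in R₂-self-complementary extension N extension-double extension-double+1
         (trans (countUpTo-cong (2 * N) (λ a → extension-seed)) count)
       , evenD , oddD , R₂≡0

-- With N = 2j the seed is {even a < N} ∪ [N, N + j).  In a pair a < a' with a + a' = 6j - 1,
-- either N ≤ a, and then a' ∈ [N + j, 2N), outside the seed; or a < N is even, a = 2i, and then
-- a' = 2m + 1 with m ∈ [N, N + j), so a' is not in the extension because m is.
module EvenCase (j : ℕ) (2≤j : 2 ≤ j) where

  N : ℕ
  N = 2 * j

  0<N : 0 < N
  0<N = *-monoʳ-< 2 (<-≤-trans z<s 2≤j)

  seed : Subset
  seed a = if a <ᵇ N then isEven a else a <ᵇ N + j

  seed-low : ∀ {a} → a < N → seed a ≡ isEven a
  seed-low a<N rewrite <ᵇ-true a<N = refl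

  seed-high : ∀ {a} → N ≤ a → seed a ≡ (a <ᵇ N + j)
  seed-high N≤a rewrite <ᵇ-false N≤a = refl

  seed-count : countUpTo seed (2 * N) ≡ N
  seed-count = begin
    countUpTo seed (2 * N)                               ≡⟨ cong (countUpTo seed) (2*≡+ N) ⟩
    countUpTo seed (N + N)                               ≡⟨ countUpTo-split seed N N ⟩
    countUpTo (λ a → seed (N + a)) N + countUpTo seed N  ≡⟨ cong₂ _+_ upper lower ⟩
    j + j                                                ≡⟨ sym (2*≡+ j) ⟩
    N                                                    ∎
    where
    open ≡-Reasoning
    upper : countUpTo (λ a → seed (N + a)) N ≡ j
    upper = trans (countUpTo-cong N (λ a _ → trans (seed-high (m≤m+n N a)) (+-<ᵇ-+ N a j)))
                  (countUpTo-<ᵇ j N (m≤m+n j (j + 0)))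
    lower : countUpTo seed N ≡ j
    lower = trans (countUpTo-cong N (λ a → seed-low)) (countUpTo-isEven j)

  N+j≤2N : N + j ≤ 2 * N
  N+j≤2N = subst (N + j ≤_) (sym (2*≡+ N)) (+-monoʳ-≤ N (m≤m+n j (j + 0)))

  3N≡2*[3*j] : 3 * N ≡ 2 * (3 * j)
  3N≡2*[3*j] = 3*[2*j]≡2*[3*j] j
    where
    3*[2*j]≡2*[3*j] : ∀ j → 3 * (2 * j) ≡ 2 * (3 * j)
    3*[2*j]≡2*[3*j] = solve-∀

  open DoublingExtension N 0<N seed

  no-pair : ∀ a a' → suc (a + a') ≡ 2 * (3 * j) → a < a' → extension a ≡ false ⊎ extension a' ≡ false
  no-pair a a' a+a'≡ a<a' with a <? N
  ... | no a≮N = inj₂ (trans (extension-seed a'<2N) (trans (seed-high N≤a') (<ᵇ-false N+j≤a')))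
    where
    a'<2N : a' < 2 * N
    a'<2N = +-cancelˡ-< N a' (2 * N) (<-≤-trans (s≤s (+-monoˡ-≤ a' (≮⇒≥ a≮N)))
                                               (≤-reflexive (trans a+a'≡ (sym 3N≡2*[3*j]))))
    N+j≤a' : N + j ≤ a'
    N+j≤a' = half≤larger a<a' (trans a+a'≡ (cong (2 *_) (+-comm j N)))
    N≤a' : N ≤ a'
    N≤a' = ≤-trans (m≤m+n N j) N+j≤a'
  ... | yes a<N with evenOrOdd a | evenOrOdd a'
  ...   | odd i  | _ = inj₁ (trans (extension-seed (<-≤-trans a<N (m≤m+n N (N + 0))))
                                   (trans (seed-low a<N) (isEven-1+2* i)))
  ...   | even i | even m =
    ⊥-elim (2*≢1+2* (3 * j) (i + m) (trans (sym a+a'≡) (cong suc (sym (*-distribˡ-+ 2 i m)))))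
  ...   | even i | odd m = inj₂ (begin
      extension (1 + 2 * m)  ≡⟨ extension-double+1 m N≤m ⟩
      not (extension m)      ≡⟨ cong not (trans (extension-seed m<2N) (trans (seed-high N≤m) (<ᵇ-true m<N+j))) ⟩
      false                  ∎)
    where
    open ≡-Reasoning
    2*[1+i+m]≡ : ∀ i m → 2 * suc (i + m) ≡ suc (2 * i + (1 + 2 * m))
    2*[1+i+m]≡ = solve-∀
    1+i+m≡3j : suc (i + m) ≡ 3 * j
    1+i+m≡3j = *-cancelˡ-≡ (suc (i + m)) (3 * j) 2 (trans (2*[1+i+m]≡ i m) a+a'≡)
    N≤m : N ≤ m
    N≤m = +-cancelˡ-≤ j N m (subst (_≤ j + m) 1+i+m≡3j (+-monoˡ-≤ m (*-cancelˡ-< 2 i j a<N)))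
    m<N+j : m < N + j
    m<N+j = subst (m <_) (trans 1+i+m≡3j (+-comm j N)) (s≤s (m≤n+m m i))
    m<2N : m < 2 * N
    m<2N = <-≤-trans m<N+j N+j≤2N

  admissible : Admissible N extension
  admissible = extension-admissible seed-count j ≤-refl
    (trans (extension-seed N<2N) (trans (seed-high ≤-refl) (<ᵇ-true (m<m+n N (<-≤-trans z<s 2≤j)))))
    (trans (extension-seed 1+N<2N) (trans (seed-high (n≤1+n N)) (<ᵇ-true 1+N<N+j)))
    (R₂≡0 extension (3 * N ∸ 1) (λ a a' a+a'≡ →
      no-pair a a' (trans (cong suc a+a'≡) (trans (1+[n∸1]≡n (*-monoʳ-< 3 0<N)) 3N≡2*[3*j]))))
    where
    1+N<N+j : suc N < N + j
    1+N<N+j = subst (_< N + j) (+-comm N 1) (+-monoʳ-< N 2≤j)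
    1+N<2N : suc N < 2 * N
    1+N<2N = <-≤-trans 1+N<N+j N+j≤2N
    N<2N : N < 2 * N
    N<2N = <-trans (n<1+n N) 1+N<2N

-- With N = 2j + 1 the seed is {even a with 0 < a < N} ∪ [N + j, 2N).  In a pair a < a' with
-- a + a' = 6j + 2, either N ≤ a < N + j, outside the seed; or a < N is even and positive, a = 2i,
-- and then a' = 2m with m ∈ [N, N + j), so a' is not in the extension because m is not.
module OddCase (k : ℕ) where

  j : ℕ
  j = suc k

  N : ℕ
  N = 1 + 2 * j

  seed : Subset
  seed a = if a <ᵇ N then isEven a ∧ not (a ≡ᵇ 0) else not (a <ᵇ N + j)

  seed-low : ∀ {a} → a < N → seed a ≡ (isEven a ∧ not (a ≡ᵇ 0))
  seed-low a<N rewrite <ᵇ-true a<N = refl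

  seed-high : ∀ {a} → N ≤ a → seed a ≡ not (a <ᵇ N + j)
  seed-high N≤a rewrite <ᵇ-false N≤a = refl

  seed-count : countUpTo seed (2 * N) ≡ N
  seed-count = begin
    countUpTo seed (2 * N)                               ≡⟨ cong (countUpTo seed) (2*≡+ N) ⟩
    countUpTo seed (N + N)                               ≡⟨ countUpTo-split seed N N ⟩
    countUpTo (λ a → seed (N + a)) N + countUpTo seed N  ≡⟨ cong₂ _+_ upper lower ⟩
    suc j + j                                            ≡⟨ cong suc (sym (2*≡+ j)) ⟩
    N                                                    ∎
    where
    open ≡-Reasoning
    upper : countUpTo (λ a → seed (N + a)) N ≡ suc j
    upper = trans (countUpTo-cong N (λ a _ → trans (seed-high (m≤m+n N a)) (cong not (+-<ᵇ-+ N a j))))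
      (+-cancelˡ-≡ j _ _ (begin
        j + countUpTo (λ a → not (a <ᵇ j)) N
          ≡⟨ cong (_+ countUpTo (λ a → not (a <ᵇ j)) N)
                  (sym (countUpTo-<ᵇ j N (≤-trans (m≤m+n j (j + 0)) (n≤1+n (2 * j))))) ⟩
        countUpTo (_<ᵇ j) N + countUpTo (λ a → not (a <ᵇ j)) N
          ≡⟨ countUpTo-∧-split (λ _ → true) (_<ᵇ j) N ⟩
        countUpTo (λ _ → true) N
          ≡⟨ countUpTo-true (λ _ → true) N (λ _ _ → refl) ⟩
        suc (2 * j)
          ≡⟨ trans (cong suc (2*≡+ j)) (sym (+-suc j j)) ⟩
        j + suc j ∎))
    lower : countUpTo seed N ≡ j
    lower = trans (countUpTo-cong N (λ a → seed-low)) (+-cancelˡ-≡ 1 _ _ (begin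
      1 + countUpTo (λ a → isEven a ∧ not (a ≡ᵇ 0)) N
        ≡⟨ cong (_+ countUpTo (λ a → isEven a ∧ not (a ≡ᵇ 0)) N) (sym (countUpTo-≡ᵇ isEven 0 N z<s)) ⟩
      countUpTo (λ a → isEven a ∧ (a ≡ᵇ 0)) N + countUpTo (λ a → isEven a ∧ not (a ≡ᵇ 0)) N
        ≡⟨ countUpTo-∧-split isEven (_≡ᵇ 0) N ⟩
      𝟙 (isEven (2 * j)) + countUpTo isEven (2 * j)
        ≡⟨ cong₂ (λ b c → 𝟙 b + c) (isEven-2* j) (countUpTo-isEven j) ⟩
      1 + j ∎))

  N+j≤2N : N + j ≤ 2 * N
  N+j≤2N = subst (N + j ≤_) (sym (2*≡+ N)) (+-monoʳ-≤ N (m≤n⇒m≤1+n (m≤m+n j (j + 0))))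

  open DoublingExtension N z<s seed

  no-pair : ∀ a a' → a + a' ≡ 2 * (1 + 3 * j) → a < a' → extension a ≡ false ⊎ extension a' ≡ false
  no-pair a a' a+a'≡ a<a' with a <? N
  ... | no a≮N = inj₁ (trans (extension-seed (<-≤-trans a<N+j N+j≤2N))
                             (trans (seed-high (≮⇒≥ a≮N)) (cong not (<ᵇ-true a<N+j))))
    where
    a<N+j : a < N + j
    a<N+j = subst (a <_) (cong suc (+-comm j (2 * j))) (smaller<half a<a' a+a'≡)
  ... | yes a<N with evenOrOdd a | evenOrOdd a'
  ...   | odd i        | _ = inj₁ (trans (extension-seed (<-≤-trans a<N (m≤m+n N (N + 0))))
                                         (trans (seed-low a<N) (cong (_∧ not (1 + 2 * i ≡ᵇ 0)) (isEven-1+2* i))))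
  ...   | even zero    | _ = inj₁ (extension-seed (<-≤-trans a<N (m≤m+n N (N + 0))))
  ...   | even (suc i) | odd m =
    ⊥-elim (2*≢1+2* (1 + 3 * j) (suc i + m) (trans (sym a+a'≡) (2*[1+i]+[1+2*m]≡ i m)))
    where
    2*[1+i]+[1+2*m]≡ : ∀ i m → 2 * suc i + (1 + 2 * m) ≡ 1 + 2 * (suc i + m)
    2*[1+i]+[1+2*m]≡ = solve-∀
  ...   | even (suc i) | even m = inj₂ (begin
      extension (2 * m)  ≡⟨ extension-double m N≤m ⟩
      extension m        ≡⟨ trans (extension-seed (<-≤-trans m<N+j N+j≤2N)) (seed-high N≤m) ⟩
      not (m <ᵇ N + j)   ≡⟨ cong not (<ᵇ-true m<N+j) ⟩
      false              ∎)
    where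
    open ≡-Reasoning
    1+i+m≡ : suc i + m ≡ 1 + 3 * j
    1+i+m≡ = *-cancelˡ-≡ (suc i + m) (1 + 3 * j) 2 (trans (*-distribˡ-+ 2 (suc i) m) a+a'≡)
    N≤m : N ≤ m
    N≤m = +-cancelˡ-≤ j N m (subst (_≤ j + m) (trans 1+i+m≡ (sym (+-suc j (2 * j))))
                                   (+-monoˡ-≤ m (*-cancelˡ-≤ 2 (≤-pred a<N))))
    m<N+j : m < N + j
    m<N+j = subst (m <_) (trans 1+i+m≡ (cong suc (+-comm j (2 * j)))) (s≤s (m≤n+m m i))

  admissible : Admissible N extension
  admissible = extension-admissible seed-count (2 * j) N≤4j
    (trans (extension-seed (<-trans (n<1+n _) 1+4j<2N)) (trans (seed-high N≤4j) (cong not (<ᵇ-false N+j≤4j))))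
    (trans (extension-seed 1+4j<2N)
           (trans (seed-high (m≤n⇒m≤1+n N≤4j)) (cong not (<ᵇ-false (m≤n⇒m≤1+n N+j≤4j)))))
    (R₂≡0 extension (3 * N ∸ 1) (λ a a' a+a'≡ → no-pair a a' (trans a+a'≡ (3N∸1≡2*[1+3*j] k))))
    where
    4*j≡N+j+k : ∀ k → 2 * (2 * suc k) ≡ (1 + 2 * suc k + suc k) + k
    4*j≡N+j+k = solve-∀
    2*N≡2+4*j : ∀ k → 2 * (1 + 2 * suc k) ≡ 2 + 2 * (2 * suc k)
    2*N≡2+4*j = solve-∀
    3N∸1≡2*[1+3*j] : ∀ k → 2 * suc k + 2 * (1 + 2 * suc k) ≡ 2 * (1 + 3 * suc k)
    3N∸1≡2*[1+3*j] = solve-∀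
    N+j≤4j : N + j ≤ 2 * (2 * j)
    N+j≤4j = subst (N + j ≤_) (sym (4*j≡N+j+k k)) (m≤m+n (N + j) k)
    N≤4j : N ≤ 2 * (2 * j)
    N≤4j = ≤-trans (m≤m+n N j) N+j≤4j
    1+4j<2N : 1 + 2 * (2 * j) < 2 * N
    1+4j<2N = subst (1 + 2 * (2 * j) <_) (sym (2*N≡2+4*j k)) ≤-refl

theorem3 : (N : ℕ) → 3 ≤ N →
    ∃[ A ] (((n : ℕ) → 2 * N ∸ 1 ≤ n → R₂ A n ≡ R₂ (compl A) n)
    × ((m : ℕ) → ∃[ a ] (m ≤ a × A a ≡ true × 2 ∣ D a))
    × ((m : ℕ) → ∃[ a ] (m ≤ a × A a ≡ true × ¬ (2 ∣ D a)))
    × R₂ A (3 * N ∸ 1) ≡ 0)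
theorem3 N 3≤N with evenOrOdd N
... | even j      = _ , EvenCase.admissible j (*-cancelˡ-< 2 1 j 3≤N)
... | odd zero    = ⊥-elim (<⇒≱ 3≤N (s≤s z≤n))
... | odd (suc k) = _ , OddCase.admissible k
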